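{- Let $m,m',n,n'$ be positive integers with $n \ge m \ge 2$ and $n' \ge m' \ge 2$. Then the outcome of the Maker-Breaker domination game on $K_{m,n} \square K_{m',n'}$ is $\mathcal{D}$, i.e., Dominator has a winning strategy both in the D-game and in the S-game.
   Context: The Maker-Breaker domination game on a finite graph $G$ is played by Dominator and Staller, who alternately claim a previously unplayed vertex of $G$ until all vertices are played. Dominator wins if his claimed vertices form a dominating set of $G$; otherwise Staller wins. The D-game is the game where Dominator moves first, the S-game where Staller moves first. The outcome is $\mathcal{D}$ if Dominator has a winning strategy in both games. $K_{m,n}$ is the complete bipartite graph with parts of sizes $m$ and $n$, and $G\square H$ is the Cartesian product (vertex set $V(G)\times V(H)$, $(g,h)\sim(g',h')$ iff either $gg'\in E(G)$ and $h=h'$, or $g=g'$ and $hh'\in E(H)$). -}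

module Defs where

open import Level using (0ℓ)
open import Data.Nat using (ℕ)
open import Data.Fin using (Fin)
open import Data.Sum using (_⊎_; inj₁; inj₂)
open import Data.Product using (Σ; _×_; _,_)
open import Data.Unit using (⊤)
open import Data.Empty using (⊥)
open import Data.List using (List; []; _∷_)
open import Data.List.Membership.Propositional using (_∈_; _∉_)
open import Relation.Binary.PropositionalEquality using (_≡_)

record Graph : Set₁ where
  field
    V   : Set
    Adj : V → V → Set
open Graph public

BipAdj : (m n : ℕ) → (Fin m ⊎ Fin n) → (Fin m ⊎ Fin n) → Set
BipAdj m n (inj₁ _) (inj₁ _) = ⊥
BipAdj m n (inj₁ _) (inj₂ _) = ⊤
BipAdj m n (inj₂ _) (inj₁ _) = ⊤
BipAdj m n (inj₂ _) (inj₂ _) = ⊥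

K : ℕ → ℕ → Graph
K m n = record { V = Fin m ⊎ Fin n ; Adj = BipAdj m n }

_□_ : Graph → Graph → Graph
G □ H = record
  { V   = V G × V H
  ; Adj = λ { (g , h) (g' , h') →
              (Adj G g g' × h ≡ h') ⊎ (g ≡ g' × Adj H h h') } }

Dominates : (G : Graph) → List (V G) → Set
Dominates G D = (v : V G) → Σ (V G) λ u → u ∈ D × (u ≡ v ⊎ Adj G u v)

data Player : Set where
  dominator staller : Player

Free : (G : Graph) → List (V G) → List (V G) → V G → Set
Free G D S v = v ∉ D × v ∉ S

-- DWins G p D S : in the position where Dominator has claimed D, Staller has
-- claimed S, and player p is to move, Dominator has a winning strategy.
data DWins (G : Graph) : Player → List (V G) → List (V G) → Set where
  finished : ∀ {p D S} →
             ((v : V G) → v ∈ D ⊎ v ∈ S) → Dominates G D → DWins G p D S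
  dmove    : ∀ {D S} (v : V G) → Free G D S v →
             DWins G staller (v ∷ D) S → DWins G dominator D S
  smove    : ∀ {D S} → Σ (V G) (Free G D S) →
             ((v : V G) → Free G D S v → DWins G dominator D (v ∷ S)) →
             DWins G staller D S

DominatorWinsDGame : Graph → Set
DominatorWinsDGame G = DWins G dominator [] []

DominatorWinsSGame : Graph → Set
DominatorWinsSGame G = DWins G staller [] []

OutcomeD : Graph → Set
OutcomeD G = DominatorWinsDGame G × DominatorWinsSGame G

{-# OPTIONS --safe #-}

-- Dominator wins by a pairing strategy. Call a vertex pairing (an involution, whose
-- fixed points are the unpaired vertices) dominating if every closed neighbourhood
-- contains a whole pair. Whenever Staller claims a paired vertex, Dominator claims its
-- partner if it is still free, and otherwise any free vertex. Then every pair ends up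
-- with a vertex of Dominator, so his final set dominates, whoever moves first.
-- In K_{m,n} with m, n ≥ 2 the two transpositions of the first two vertices of each part
-- form a dominating pairing, and pairing along the first factor lifts it to K_{m,n} □ H.

module Submission where

open import Defs
open import Level using (Level)
open import Data.Nat using (ℕ; suc; _≤_; _<_; z≤n; s≤s)
open import Data.Nat.Properties using (<-trans; m≤n⇒m≤1+n; m<n⇒m<1+n)
open import Data.Nat.Induction using (<-wellFounded)
open import Data.Product using (_×_; Σ; _,_; proj₁)
import Data.Product.Properties as Product
open import Data.Sum using (_⊎_; inj₁; inj₂) renaming (map to map-⊎)
import Data.Sum.Properties as Sum
open import Data.Unit using (tt)
open import Data.Fin using (Fin; zero; suc)
import Data.Fin.Properties as Fin
open import Data.List using (List; []; _∷_; map; _++_; allFin; cartesianProduct; filter; length)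
open import Data.List.Relation.Unary.Any using (here; there; any?; satisfied)
open import Data.List.Membership.Propositional using (_∈_; _∉_; lose)
open import Data.List.Membership.Propositional.Properties
  using (∈-map⁺; ∈-++⁺ˡ; ∈-++⁺ʳ; ∈-cartesianProduct⁺; ∈-allFin)
open import Induction.WellFounded using (Acc; acc)
open import Relation.Nullary using (¬_; yes; no; ¬?; contradiction)
open import Relation.Nullary.Decidable using (_×-dec_)
open import Relation.Unary using (Pred; Decidable; _⊆_)
open import Relation.Binary.Definitions using (DecidableEquality)
open import Relation.Binary.PropositionalEquality using (_≡_; _≢_; refl; sym; trans; subst; cong)

private
  variable
    a p q : Level
    A : Set a

module _ {P : Pred A p} {Q : Pred A q} (P? : Decidable P) (Q? : Decidable Q)
         (P⊆Q : P ⊆ Q) where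

  length-filter-mono : ∀ xs → length (filter P? xs) ≤ length (filter Q? xs)
  length-filter-mono [] = z≤n
  length-filter-mono (x ∷ xs) with P? x | Q? x
  ... | yes _  | yes _   = s≤s (length-filter-mono xs)
  ... | yes px | no ¬qx  = contradiction (P⊆Q px) ¬qx
  ... | no _   | yes _   = m≤n⇒m≤1+n (length-filter-mono xs)
  ... | no _   | no _    = length-filter-mono xs

  length-filter-mono-< : ∀ {v xs} → v ∈ xs → Q v → ¬ P v →
                         length (filter P? xs) < length (filter Q? xs)
  length-filter-mono-< {xs = x ∷ xs} (here refl) qv ¬pv with P? x | Q? x
  ... | yes pv | _      = contradiction pv ¬pv
  ... | no _   | yes _  = s≤s (length-filter-mono xs)
  ... | no _   | no ¬qv = contradiction qv ¬qv
  length-filter-mono-< {xs = x ∷ xs} (there v∈xs) qv ¬pv with P? x | Q? x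
  ... | yes _  | yes _  = s≤s (length-filter-mono-< v∈xs qv ¬pv)
  ... | yes px | no ¬qx = contradiction (P⊆Q px) ¬qx
  ... | no _   | yes _  = m<n⇒m<1+n (length-filter-mono-< v∈xs qv ¬pv)
  ... | no _   | no _   = length-filter-mono-< v∈xs qv ¬pv

IsEnumeration : List A → Set _
IsEnumeration xs = ∀ x → x ∈ xs

ClosedAdj : (G : Graph) → V G → V G → Set
ClosedAdj G u v = u ≡ v ⊎ Adj G u v

record DominatingPairing (G : Graph) : Set where
  field
    partner            : V G → V G
    partner-involutive : ∀ x → partner (partner x) ≡ x
    dominatingPair     : ∀ v → Σ (V G) λ x →
                         partner x ≢ x × ClosedAdj G x v × ClosedAdj G (partner x) v

module PairingStrategy (G : Graph) (_≟_ : DecidableEquality (V G))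
                       {vertices : List (V G)} (enum : IsEnumeration vertices)
                       (pairing : DominatingPairing G) where

  open DominatingPairing pairing
  open import Data.List.Membership.DecPropositional _≟_ using (_∈?_)

  Claimed : List (V G) → List (V G) → Set
  Claimed D S = ∀ v → v ∈ D ⊎ v ∈ S

  Answered : List (V G) → List (V G) → Set
  Answered D S = ∀ x → x ∈ S → partner x ≡ x ⊎ partner x ∈ D

  free? : ∀ D S → Decidable (Free G D S)
  free? D S x = ¬? (x ∈? D) ×-dec ¬? (x ∈? S)

  freeCount : List (V G) → List (V G) → ℕ
  freeCount D S = length (filter (free? D S) vertices)

  freeCount-dominatorMove : ∀ {D S v} → Free G D S v → freeCount (v ∷ D) S < freeCount D S
  freeCount-dominatorMove {D} {S} {v} free =
    length-filter-mono-< (free? (v ∷ D) S) (free? D S)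
      (λ (∉vD , ∉S) → (λ ∈D → ∉vD (there ∈D)) , ∉S)
      (enum v) free (λ (∉vD , _) → ∉vD (here refl))

  freeCount-stallerMove : ∀ {D S v} → Free G D S v → freeCount D (v ∷ S) < freeCount D S
  freeCount-stallerMove {D} {S} {v} free =
    length-filter-mono-< (free? D (v ∷ S)) (free? D S)
      (λ (∉D , ∉vS) → ∉D , λ ∈S → ∉vS (there ∈S))
      (enum v) free (λ (_ , ∉vS) → ∉vS (here refl))

  freeVertex⊎claimed : ∀ D S → Σ (V G) (Free G D S) ⊎ Claimed D S
  freeVertex⊎claimed D S with any? (free? D S) vertices
  ... | yes someFree = inj₁ (satisfied someFree)
  ... | no noneFree  = inj₂ claimed
    where
    claimed : Claimed D S
    claimed v with v ∈? D | v ∈? S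
    ... | yes v∈D | _      = inj₁ v∈D
    ... | no _    | yes v∈S = inj₂ v∈S
    ... | no v∉D  | no v∉S  = contradiction (lose (enum v) (v∉D , v∉S)) noneFree

  answered⇒dominates : ∀ {D S} → Answered D S → Claimed D S → Dominates G D
  answered⇒dominates answered claimed v
    with x , partner≢x , x⊙v , partner⊙v ← dominatingPair v
    with claimed x
  ... | inj₁ x∈D = x , x∈D , x⊙v
  ... | inj₂ x∈S with answered x x∈S
  ...   | inj₁ partner≡x = contradiction partner≡x partner≢x
  ...   | inj₂ partner∈D = partner x , partner∈D , partner⊙v

  answered-dominatorMove : ∀ {D S u} → Answered D S → Answered (u ∷ D) S
  answered-dominatorMove answered x x∈S with answered x x∈S
  ... | inj₁ fixed = inj₁ fixed
  ... | inj₂ partner∈D = inj₂ (there partner∈D)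

  answered-reply : ∀ {D S v} → Answered D S → Answered (partner v ∷ D) (v ∷ S)
  answered-reply answered x (here refl) = inj₂ (here refl)
  answered-reply answered x (there x∈S) = answered-dominatorMove answered x x∈S

  -- Staller cannot already own the partner of v: Dominator would have answered it with v.
  answered⊎partnerFree : ∀ {D S v} → Answered D S → v ∉ D →
                         Answered D (v ∷ S) ⊎ Free G D (v ∷ S) (partner v)
  answered⊎partnerFree {D} {S} {v} answered v∉D
    with partner v ≟ v | partner v ∈? D | partner v ∈? S
  ... | yes fixed | _ | _ =
    inj₁ λ { x (here refl) → inj₁ fixed ; x (there x∈S) → answered x x∈S }
  ... | no _ | yes partner∈D | _ =
    inj₁ λ { x (here refl) → inj₂ partner∈D ; x (there x∈S) → answered x x∈S }
  ... | no moved | no _ | yes partner∈S with answered (partner v) partner∈S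
  ...   | inj₁ fixed = contradiction (sym (trans (sym (partner-involutive v)) fixed)) moved
  ...   | inj₂ v∈D = contradiction (subst (_∈ D) (partner-involutive v) v∈D) v∉D
  answered⊎partnerFree {D} {S} {v} answered v∉D
      | no moved | no partner∉D | no partner∉S =
    inj₂ (partner∉D , λ { (here fixed) → moved fixed ; (there partner∈S) → partner∉S partner∈S })

  dominatorTurn : ∀ {D S} → Acc _<_ (freeCount D S) → Answered D S → DWins G dominator D S
  stallerTurn   : ∀ {D S} → Acc _<_ (freeCount D S) → Answered D S → DWins G staller D S
  reply         : ∀ {D S v} → Acc _<_ (freeCount D S) → Answered D S → Free G D S v →
                  DWins G dominator D (v ∷ S)

  dominatorTurn {D} {S} (acc rs) answered with freeVertex⊎claimed D S
  ... | inj₂ claimed = finished claimed (answered⇒dominates answered claimed)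
  ... | inj₁ (v , free) =
    dmove v free (stallerTurn (rs (freeCount-dominatorMove free)) (answered-dominatorMove answered))

  stallerTurn {D} {S} accessible answered with freeVertex⊎claimed D S
  ... | inj₂ claimed = finished claimed (answered⇒dominates answered claimed)
  ... | inj₁ someFree = smove someFree λ v free → reply accessible answered free

  reply (acc rs) answered free with answered⊎partnerFree answered (proj₁ free)
  ... | inj₁ answered′ = dominatorTurn (rs (freeCount-stallerMove free)) answered′
  ... | inj₂ partnerFree =
    dmove _ partnerFree
      (stallerTurn (rs (<-trans (freeCount-dominatorMove partnerFree) (freeCount-stallerMove free)))
                   (answered-reply answered))

  outcomeD : OutcomeD G
  outcomeD = dominatorTurn (<-wellFounded _) (λ _ ()) , stallerTurn (<-wellFounded _) (λ _ ())

module _ {G : Graph} (H : Graph) where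

  □-closedAdjˡ : ∀ {u v} h → ClosedAdj G u v → ClosedAdj (G □ H) (u , h) (v , h)
  □-closedAdjˡ h (inj₁ refl) = inj₁ refl
  □-closedAdjˡ h (inj₂ u~v) = inj₂ (inj₁ (u~v , refl))

  □-dominatingPairingˡ : DominatingPairing G → DominatingPairing (G □ H)
  □-dominatingPairingˡ pairing = record
    { partner            = λ (g , h) → partner g , h
    ; partner-involutive = λ (g , h) → cong (_, h) (partner-involutive g)
    ; dominatingPair     = λ (g , h) →
        let x , partner≢x , x⊙g , partner⊙g = dominatingPair g
        in (x , h) , (λ eq → partner≢x (cong proj₁ eq))
                   , □-closedAdjˡ h x⊙g , □-closedAdjˡ h partner⊙g
    }
    where open DominatingPairing pairing

swap01 : ∀ {n} → Fin (suc (suc n)) → Fin (suc (suc n))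
swap01 zero          = suc zero
swap01 (suc zero)    = zero
swap01 (suc (suc i)) = suc (suc i)

swap01-involutive : ∀ {n} (i : Fin (suc (suc n))) → swap01 (swap01 i) ≡ i
swap01-involutive zero          = refl
swap01-involutive (suc zero)    = refl
swap01-involutive (suc (suc i)) = refl

K-dominatingPairing : ∀ m n → DominatingPairing (K (suc (suc m)) (suc (suc n)))
K-dominatingPairing m n = record
  { partner            = map-⊎ swap01 swap01
  ; partner-involutive = λ { (inj₁ i) → cong inj₁ (swap01-involutive i)
                           ; (inj₂ j) → cong inj₂ (swap01-involutive j) }
  ; dominatingPair     = λ { (inj₁ _) → inj₂ zero , (λ ()) , inj₂ tt , inj₂ tt
                           ; (inj₂ _) → inj₁ zero , (λ ()) , inj₂ tt , inj₂ tt }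
  }

K-≟ : ∀ m n → DecidableEquality (V (K m n))
K-≟ m n = Sum.≡-dec Fin._≟_ Fin._≟_

K-vertices : ∀ m n → List (V (K m n))
K-vertices m n = map inj₁ (allFin m) ++ map inj₂ (allFin n)

K-vertices-isEnumeration : ∀ m n → IsEnumeration (K-vertices m n)
K-vertices-isEnumeration m n (inj₁ i) = ∈-++⁺ˡ (∈-map⁺ inj₁ (∈-allFin i))
K-vertices-isEnumeration m n (inj₂ j) = ∈-++⁺ʳ (map inj₁ (allFin m)) (∈-map⁺ inj₂ (∈-allFin j))

cartesianProduct-isEnumeration : ∀ {B : Set} {xs : List A} {ys : List B} →
  IsEnumeration xs → IsEnumeration ys → IsEnumeration (cartesianProduct xs ys)
cartesianProduct-isEnumeration enumA enumB (x , y) = ∈-cartesianProduct⁺ (enumA x) (enumB y)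

corollary4p2 : (m n m' n' : ℕ) → 2 ≤ m → m ≤ n → 2 ≤ m' → m' ≤ n' →
    OutcomeD (K m n □ K m' n')
corollary4p2 m@(suc (suc _)) n@(suc (suc _)) m' n' (s≤s (s≤s _)) (s≤s (s≤s _)) _ _ =
  PairingStrategy.outcomeD (K m n □ K m' n')
    (Product.≡-dec (K-≟ m n) (K-≟ m' n'))
    (cartesianProduct-isEnumeration (K-vertices-isEnumeration m n) (K-vertices-isEnumeration m' n'))
    (□-dominatingPairingˡ (K m' n') (K-dominatingPairing _ _))
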